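{- In the setting described in the context, for every assignment of pairwise distinct values $\rho(v)\in[0,1]$ to the nodes, and for any pair of nodes $u,v \in V$ such that $d(u,v) \in [\mathcal{D}, 5\mathcal{D}/4]$, we have $$d(u,v) = \min_{w\in S_{\mathcal{D}}(u)\cap S_{\mathcal{D}}(v)} \left( d(u,w) + d(w,v)\right).$$
   Context: $G=(V,E)$ is a connected unweighted undirected graph with $n=|V|$ nodes and distance $d$. Fix an integer $\mathcal{D}>0$ with $12\mid\mathcal{D}$. For each pair of nodes $u,v$ a shortest path $P(u,v)$ is fixed, with ties broken consistently so that $P(u,v)=P(v,u)$ and, for each $u$, $\bigcup_{v\in V}P(u,v)$ is a spanning tree of $G$. For $u\in V$, $T_u:=\bigcup_{v\in V: d(u,v)\in[\mathcal{D},5\mathcal{D}/4]}P(u,v)$, a tree rooted at $u$, and $T_u^*$ is the subtree of $T_u$ induced by its nodes at distance at most $3\mathcal{D}/4$ from $u$. $H_u$ is the set of nodes $w$ of $T_u^*$ such that the subtree of $T_u^*$ rooted at $w$ has at least $\mathcal{D}$ leaves, and $L_u:=V(T_u^*)\setminus H_u$. A descending subpath is a path one of whose endpoints is an ancestor of the other with respect to $T_u^*$ rooted at $u$; $|P|$ denotes the number of edges of $P$. Each node $v$ carries a value $\rho(v)\in[0,1]$. $L_u'$ is the set of all $v\in L_u$ for which there is a descending subpath $P_d$ of the forest $T_u^*[L_u]$ with $v\in P_d$, $|P_d|=\mathcal{D}/12$ and $v=\arg\min_{w\in P_d}\rho(w)$. Finally $S_{\mathcal{D}}(u):=H_u\cup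 L_u'$.
   Formalization: The pairwise distinct values $\rho(v)\in[0,1]$ assigned to the nodes are rational numbers. -}

module Defs where

open import Data.Nat using (ℕ; zero; suc; _+_; _*_; _∸_; _≤_; _<_)
open import Data.Nat.Divisibility using (_∣_)
open import Data.Nat.DivMod using (_/_)
open import Data.Fin using (Fin)
open import Data.List using (List; []; _∷_; head; last; length; reverse; _++_)
open import Data.List.Membership.Propositional using (_∈_)
open import Data.List.Relation.Unary.Linked using (Linked)
open import Data.List.Relation.Unary.Unique.Propositional using (Unique)
open import Data.Maybe using (just)
open import Data.Product using (Σ; ∃; ∃-syntax; _×_; _,_)
open import Data.Sum using (_⊎_)
open import Data.Empty using (⊥)
open import Data.Rational as ℚ using (ℚ; 0ℚ; 1ℚ)
open import Relation.Nullary using (¬_)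
open import Relation.Binary.PropositionalEquality using (_≡_)
open import Function.Definitions using (Injective)

module _ {n : ℕ} where

  V : Set
  V = Fin n

  -- a walk from u to v in the graph with adjacency E, given by its
  -- vertex sequence p (number of edges = length p ∸ 1)
  record IsWalk (E : V → V → Set) (u v : V) (p : List V) : Set where
    field
      starts : head p ≡ just u
      ends   : last p ≡ just v
      linked : Linked E p

  SimpleGraph : (E : V → V → Set) → Set
  SimpleGraph E = (∀ x y → E x y → E y x) × (∀ x → ¬ E x x)

  Connected : (E : V → V → Set) → Set
  Connected E = ∀ u v → ∃[ p ] IsWalk E u v p

  IsCycle : (E : V → V → Set) → List V → Set
  IsCycle E c = (3 ≤ length c) × Unique c × Linked E c
              × ∃[ x ] ∃[ y ] (head c ≡ just x × last c ≡ just y × E y x)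

  Acyclic : (E : V → V → Set) → Set
  Acyclic E = ∀ c → ¬ IsCycle E c

  IsSpanningTree : (E : V → V → Set) → Set
  IsSpanningTree E = Connected E × Acyclic E

  -- d is the shortest-path distance of the graph E
  -- (length of a walk = number of its edges = length of vertex list ∸ 1)
  IsDistance : (E : V → V → Set) → (V → V → ℕ) → Set
  IsDistance E d = ∀ u v →
      (∃[ p ] (IsWalk E u v p × length p ≡ suc (d u v)))
    × (∀ p → IsWalk E u v p → suc (d u v) ≤ length p)

  Consecutive : List V → V → V → Set
  Consecutive p x y = ∃[ as ] ∃[ bs ] (p ≡ as ++ (x ∷ y ∷ bs))

  UnionEdge : (P : V → V → List V) → V → V → V → Set
  UnionEdge P u x y = ∃[ v ] (Consecutive (P u v) x y ⊎ Consecutive (P u v) y x)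

  IsPathSystem : (E : V → V → Set) → (V → V → ℕ) → (V → V → List V) → Set
  IsPathSystem E d P =
      (∀ u v → IsWalk E u v (P u v) × length (P u v) ≡ suc (d u v))
    × (∀ u v → P v u ≡ reverse (P u v))
    × (∀ u → IsSpanningTree (UnionEdge P u))

module Setting {n : ℕ} (d : V {n} → V {n} → ℕ) (P : V {n} → V {n} → List (V {n}))
               (𝒟 : ℕ) (ρ : V {n} → ℚ) where

  InRange : ℕ → Set
  InRange k = 𝒟 ≤ k × 4 * k ≤ 5 * 𝒟

  InT : V → V → Set
  InT u x = ∃[ v ] (InRange (d u v) × x ∈ P u v)

  -- w is an ancestor of x (or equal to x) in T_u rooted at u:
  -- both lie on a common root path P(u,v) of T_u, w not deeper than x
  Anc : V → V → V → Set
  Anc u w x = ∃[ v ] (InRange (d u v) × w ∈ P u v × x ∈ P u v × d u w ≤ d u x)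

  InTs : V → V → Set
  InTs u x = InT u x × 4 * d u x ≤ 3 * 𝒟

  Child : V → V → V → Set
  Child u x y = InTs u y × Anc u x y × d u y ≡ suc (d u x)

  Leaf : V → V → Set
  Leaf u x = InTs u x × (∀ y → ¬ Child u x y)

  -- the subtree of T_u^* rooted at w has at least 𝒟 leaves
  -- (there are 𝒟 pairwise distinct leaves of T_u^* descending from w)
  ManyLeaves : V → V → Set
  ManyLeaves u w = ∃[ f ] (Injective _≡_ _≡_ f × ∀ (i : Fin 𝒟) → Leaf u (f i) × Anc u w (f i))

  H : V → V → Set
  H u w = InTs u w × ManyLeaves u w

  L : V → V → Set
  L u w = InTs u w × ¬ ManyLeaves u w

  -- x lies on the descending subpath of T_u^* with upper endpoint a and
  -- lower endpoint b
  OnSeg : V → V → V → V → Set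
  OnSeg u a b x = Anc u a x × Anc u x b

  L′ : V → V → Set
  L′ u v = L u v × ∃[ a ] ∃[ b ]
      ( Anc u a b
      × d u a + 𝒟 / 12 ≡ d u b
      × (∀ x → OnSeg u a b x → L u x)
      × OnSeg u a b v
      × (∀ x → OnSeg u a b x → ρ v ℚ.≤ ρ x))

  S : V → V → Set
  S u w = H u w ⊎ L′ u w

-- Write 𝒟 = 12q and d(u,v) = 12q + f, so 0 ≤ f ≤ 3q and T^* has depth 9q.  Since ⋃ᵥ P(u,v) is a tree,
-- its root paths are prefix-closed; hence along P(u,v) ancestors of vertices of H_u lie in H_u and
-- descendants of vertices of L_u lie in L_u.  Let x be the vertex of P(u,v) at depth 4q + f from u,
-- i.e. 8q from v.  If x ∈ H_u ∩ H_v it is the required w.  Otherwise take a window of q = 𝒟/12 edges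
-- of P(u,v) that, seen from each endpoint, lies above a vertex of H or below a vertex of L (from u:
-- depths [3q+f, 4q+f], [8q, 9q] or [4q+f, 5q+f] in the three remaining cases).  The ρ-minimum of the
-- window then lies in H, or in L′ with the window itself as P_d, from both ends.

module Submission where

open import Defs
open import Data.Nat using (ℕ; zero; suc; _+_; _*_; _≤_; _<_; _≤?_; z≤n; s≤s; s≤s⁻¹; z<s)
open import Data.Nat.Properties
open import Data.Nat.Divisibility using (_∣_; divides)
open import Data.Nat.DivMod using (_/_; m*n/n≡m)
open import Data.Nat.Tactic.RingSolver using (solve-∀)
open import Data.Fin using (Fin; inject≤)
import Data.Fin.Properties as Fin
open import Data.List using (List; []; _∷_; [_]; _++_; head; last; length; reverse; filter; allFin; lookup)
open import Data.List.Properties using (++-assoc; length-++; unfold-reverse; reverse-++; length-reverse)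
open import Data.List.Membership.Propositional using (_∈_)
open import Data.List.Membership.Propositional.Properties
  using (∈-++⁻; ∈-++⁺ˡ; ∈-++⁺ʳ; ∈-∃++; ∈-filter⁺; ∈-filter⁻; ∈-allFin; ∈-lookup)
open import Data.List.Relation.Unary.Any using (here; there; index)
open import Data.List.Relation.Unary.Any.Properties using (reverse⁺; reverse⁻; lookup-index)
open import Data.List.Relation.Unary.All using ([]; _∷_)
open import Data.List.Relation.Unary.AllPairs using ([]; _∷_)
import Data.List.Relation.Unary.All as All
open import Data.List.Relation.Unary.Linked using (Linked; []; [-]; _∷_)
import Data.List.Relation.Unary.Linked as Linked
open import Data.List.Relation.Unary.Unique.Propositional using (Unique)
import Data.List.Relation.Unary.Unique.Propositional.Properties as Unique
open import Data.Maybe using (just)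
open import Data.Maybe.Properties using (just-injective)
open import Data.Product using (∃-syntax; _×_; _,_; proj₁; proj₂)
open import Data.Sum using (inj₁; inj₂)
open import Data.Empty using (⊥; ⊥-elim)
open import Data.Rational as ℚ using (ℚ; 0ℚ; 1ℚ)
import Data.Rational.Properties as ℚ
open import Relation.Nullary using (¬_; Dec; yes; no)
open import Relation.Nullary.Decidable using (_×-dec_; ¬?)
open import Relation.Binary.PropositionalEquality hiding ([_])
open import Function.Definitions using (Injective)
open import Relation.Binary.Bundles using (DecTotalOrder)
open import Data.List.Extrema (DecTotalOrder.totalOrder ℚ.≤-decTotalOrder) using (argmin; argmin-all; f[argmin]≤f[xs])

module _ {A : Set} where

  head-++-∷ : ∀ (as : List A) x bs → head (as ++ x ∷ bs) ≡ head (as ++ [ x ])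
  head-++-∷ []       x bs = refl
  head-++-∷ (a ∷ as) x bs = refl

  last-++-[] : ∀ (as : List A) x → last (as ++ [ x ]) ≡ just x
  last-++-[] []           x = refl
  last-++-[] (a ∷ [])     x = refl
  last-++-[] (a ∷ b ∷ as) x = last-++-[] (b ∷ as) x

  last-++-∷ : ∀ (as : List A) x bs → last (as ++ x ∷ bs) ≡ last (x ∷ bs)
  last-++-∷ []           x bs = refl
  last-++-∷ (a ∷ [])     x bs = refl
  last-++-∷ (a ∷ b ∷ as) x bs = last-++-∷ (b ∷ as) x bs

  last≡just⇒∷ʳ : ∀ (xs : List A) {x} → last xs ≡ just x → ∃[ ys ] xs ≡ ys ++ [ x ]
  last≡just⇒∷ʳ (a ∷ [])     refl = [] , refl
  last≡just⇒∷ʳ (a ∷ b ∷ xs) eq   with ys , eq′ ← last≡just⇒∷ʳ (b ∷ xs) eq = a ∷ ys , cong (a ∷_) eq′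

  head≡just⇒∷ : ∀ (xs : List A) {x} → head xs ≡ just x → ∃[ ys ] xs ≡ x ∷ ys
  head≡just⇒∷ (a ∷ xs) refl = xs , refl

  reverse-++-∷ : ∀ (as : List A) x bs → reverse (as ++ x ∷ bs) ≡ reverse bs ++ x ∷ reverse as
  reverse-++-∷ as x bs = begin
    reverse (as ++ x ∷ bs)              ≡⟨ reverse-++ as (x ∷ bs) ⟩
    reverse (x ∷ bs) ++ reverse as      ≡⟨ cong (_++ reverse as) (unfold-reverse x bs) ⟩
    (reverse bs ++ [ x ]) ++ reverse as ≡⟨ ++-assoc (reverse bs) [ x ] (reverse as) ⟩
    reverse bs ++ x ∷ reverse as        ∎
    where open ≡-Reasoning

  Unique-reverse : ∀ {xs : List A} → Unique xs → Unique (reverse xs)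
  Unique-reverse {[]}     _ = []
  Unique-reverse {x ∷ xs} (x∉xs ∷ u) rewrite unfold-reverse x xs =
    Unique.++⁺ (Unique-reverse u) ([] ∷ [])
      λ { (x∈xs , here refl) → All.lookup x∉xs (reverse⁻ x∈xs) refl }

  lookup-injective : ∀ {xs : List A} → Unique xs → ∀ i j → lookup xs i ≡ lookup xs j → i ≡ j
  lookup-injective {x ∷ xs} _          Fin.zero    Fin.zero    _  = refl
  lookup-injective {x ∷ xs} (x∉ ∷ _)   Fin.zero    (Fin.suc j) eq = ⊥-elim (All.lookup x∉ (∈-lookup j) eq)
  lookup-injective {x ∷ xs} (x∉ ∷ _)   (Fin.suc i) Fin.zero    eq = ⊥-elim (All.lookup x∉ (∈-lookup i) (sym eq))
  lookup-injective {x ∷ xs} (_ ∷ u)    (Fin.suc i) (Fin.suc j) eq = cong Fin.suc (lookup-injective u i j eq)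

module _ {A : Set} {E : A → A → Set} where

  Linked-++⁻ˡ : ∀ (xs : List A) {ys} → Linked E (xs ++ ys) → Linked E xs
  Linked-++⁻ˡ []           _       = []
  Linked-++⁻ˡ (x ∷ [])     _       = [-]
  Linked-++⁻ˡ (x ∷ y ∷ xs) (e ∷ l) = e ∷ Linked-++⁻ˡ (y ∷ xs) l

  Linked-++⁻ʳ : ∀ (xs : List A) {ys} → Linked E (xs ++ ys) → Linked E ys
  Linked-++⁻ʳ []       l = l
  Linked-++⁻ʳ (x ∷ xs) l = Linked-++⁻ʳ xs (Linked.tail l)

  Linked-++-∷⁻ˡ : ∀ (xs : List A) y {ys} → Linked E (xs ++ y ∷ ys) → Linked E (xs ++ [ y ])
  Linked-++-∷⁻ˡ xs y {ys} l = Linked-++⁻ˡ (xs ++ [ y ]) (subst (Linked E) (sym (++-assoc xs [ y ] ys)) l)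

  Linked-glue : ∀ (xs : List A) y ys → Linked E (xs ++ [ y ]) → Linked E (y ∷ ys) → Linked E (xs ++ y ∷ ys)
  Linked-glue []            y ys _        l = l
  Linked-glue (x ∷ [])      y ys (e ∷ _)  l = e ∷ l
  Linked-glue (x ∷ x′ ∷ xs) y ys (e ∷ l₁) l = e ∷ Linked-glue (x′ ∷ xs) y ys l₁ l

  Linked-reverse : (∀ {x y} → E x y → E y x) → ∀ {xs : List A} → Linked E xs → Linked E (reverse xs)
  Linked-reverse E-sym {[]}         _       = []
  Linked-reverse E-sym {x ∷ []}     _       = [-]
  Linked-reverse E-sym {x ∷ y ∷ xs} (e ∷ l) rewrite unfold-reverse x (y ∷ xs) =
    Linked-glue (reverse (y ∷ xs)) x [] lr′ [-]
    where
    lr′ : Linked E (reverse (y ∷ xs) ++ [ x ])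
    lr′ rewrite unfold-reverse y xs | ++-assoc (reverse xs) [ y ] [ x ] =
      Linked-glue (reverse xs) y [ x ] (subst (Linked E) (unfold-reverse y xs) (Linked-reverse E-sym l)) (E-sym e ∷ [-])

  Linked-∷ʳ-last : ∀ z (zs : List A) a → Linked E ((z ∷ zs) ++ [ a ]) → ∃[ y ] (last (z ∷ zs) ≡ just y × E y a)
  Linked-∷ʳ-last z []       a (e ∷ _) = z , refl , e
  Linked-∷ʳ-last z (z′ ∷ zs) a (_ ∷ l) = Linked-∷ʳ-last z′ zs a l

module Ranking {A : Set} (r : A → ℕ) where

  data Ranked : ℕ → List A → Set where
    []  : ∀ {k} → Ranked k []
    _∷_ : ∀ {k x xs} → r x ≡ k → Ranked (suc k) xs → Ranked k (x ∷ xs)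

  ranked⁺ : ∀ k xs → (∀ as x bs → xs ≡ as ++ x ∷ bs → r x ≡ k + length as) → Ranked k xs
  ranked⁺ k []       _    = []
  ranked⁺ k (y ∷ xs) rank =
    trans (rank [] y xs refl) (+-identityʳ k) ∷
    ranked⁺ (suc k) xs λ as x bs eq → trans (rank (y ∷ as) x bs (cong (y ∷_) eq)) (+-suc k (length as))

  ranked-≤ : ∀ {k xs x} → Ranked k xs → x ∈ xs → k ≤ r x
  ranked-≤ (eq ∷ _)  (here refl) = ≤-reflexive (sym eq)
  ranked-≤ (_ ∷ rxs) (there x∈)  = <⇒≤ (ranked-≤ rxs x∈)

  ranked-< : ∀ {k xs x} → Ranked k xs → x ∈ xs → r x < k + length xs
  ranked-< {k} {_ ∷ xs} (eq ∷ _) (here refl) = begin-strict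
    r _              ≡⟨ eq ⟩
    k                <⟨ m<m+n k z<s ⟩
    k + suc (length xs) ∎
    where open ≤-Reasoning
  ranked-< {k} {_ ∷ xs} {x} (_ ∷ rxs) (there x∈) = subst (r x <_) (sym (+-suc k (length xs))) (ranked-< rxs x∈)

  ranked-++⁻ˡ : ∀ {k} xs {ys} → Ranked k (xs ++ ys) → Ranked k xs
  ranked-++⁻ˡ []       _          = []
  ranked-++⁻ˡ (x ∷ xs) (eq ∷ rxs) = eq ∷ ranked-++⁻ˡ xs rxs

  ranked-++⁻ʳ : ∀ {k} xs {ys} → Ranked k (xs ++ ys) → Ranked (k + length xs) ys
  ranked-++⁻ʳ {k} []       rys = subst (λ j → Ranked j _) (sym (+-identityʳ k)) rys
  ranked-++⁻ʳ {k} (x ∷ xs) {ys} (_ ∷ rxs) = subst (λ j → Ranked j ys) (sym (+-suc k (length xs))) (ranked-++⁻ʳ xs rxs)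

  ranked⇒unique : ∀ {k xs} → Ranked k xs → Unique xs
  ranked⇒unique []         = []
  ranked⇒unique (eq ∷ rxs) =
    All.tabulate (λ y∈ x≡y → <⇒≢ (subst (_< r _) (sym eq) (ranked-≤ rxs y∈)) (cong r x≡y)) ∷ ranked⇒unique rxs

  ranked-at : ∀ {k xs} i → Ranked k xs → i < length xs → ∃[ x ] (x ∈ xs × r x ≡ k + i)
  ranked-at {k} zero    (_∷_ {x = x} eq _) _ = x , here refl , trans eq (sym (+-identityʳ k))
  ranked-at {k} (suc i) (_ ∷ rxs)    (s≤s i<) with x , x∈ , eq ← ranked-at i rxs i< =
    x , there x∈ , trans eq (sym (+-suc k i))

module RankedWalks {n : ℕ} (r : V {n} → ℕ) (E : V {n} → V {n} → Set)
                   (E-sym : ∀ {x y} → E x y → E y x) (acyclic : Acyclic E) where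
  open Ranking r

  data Diverging : ℕ → List (V {n}) → List (V {n}) → Set where
    []   : ∀ {k} → Diverging k [] []
    step : ∀ {k x x′ xs xs′} → r x ≡ k → r x′ ≡ k → x ≢ x′ →
           Diverging (suc k) xs xs′ → Diverging k (x ∷ xs) (x′ ∷ xs′)

  diverging-∷ʳ : ∀ {k xs xs′ x x′} → Diverging k xs xs′ →
                 r x ≡ k + length xs → r x′ ≡ k + length xs → x ≢ x′ →
                 Diverging k (xs ++ [ x ]) (xs′ ++ [ x′ ])
  diverging-∷ʳ {k} []                        e e′ x≢x′ = step (trans e (+-identityʳ k)) (trans e′ (+-identityʳ k)) x≢x′ []
  diverging-∷ʳ {k} (step {xs = xs} a b c dv) e e′ x≢x′ =
    step a b c (diverging-∷ʳ dv (trans e (+-suc k (length xs))) (trans e′ (+-suc k (length xs))) x≢x′)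

  diverging-length : ∀ {k xs xs′} → Diverging k xs xs′ → length xs ≡ length xs′
  diverging-length []              = refl
  diverging-length (step _ _ _ dv) = cong suc (diverging-length dv)

  diverging-rankedˡ : ∀ {k xs xs′} → Diverging k xs xs′ → Ranked k xs
  diverging-rankedˡ []              = []
  diverging-rankedˡ (step e _ _ dv) = e ∷ diverging-rankedˡ dv

  diverging-rankedʳ : ∀ {k xs xs′} → Diverging k xs xs′ → Ranked k xs′
  diverging-rankedʳ []               = []
  diverging-rankedʳ (step _ e′ _ dv) = e′ ∷ diverging-rankedʳ dv

  diverging-disjoint : ∀ {k xs xs′ x} → Diverging k xs xs′ → x ∈ xs → x ∈ xs′ → ⊥
  diverging-disjoint (step _ _ x≢x′ _)  (here refl) (here refl) = x≢x′ refl
  diverging-disjoint (step e _ _ dv)    (here refl) (there x∈)  = <-irrefl (sym e) (ranked-≤ (diverging-rankedʳ dv) x∈)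
  diverging-disjoint (step _ e′ _ dv)   (there x∈)  (here refl) = <-irrefl (sym e′) (ranked-≤ (diverging-rankedˡ dv) x∈)
  diverging-disjoint (step _ _ _ dv)    (there x∈)  (there x∈′) = diverging-disjoint dv x∈ x∈′

  diverging-cycle : ∀ {k a m x xs xs′} → r a ≡ k → Diverging (suc k) (x ∷ xs) xs′ →
                    r m ≡ suc k + length (x ∷ xs) →
                    Linked E (a ∷ (x ∷ xs) ++ [ m ]) → Linked E (a ∷ xs′ ++ [ m ]) →
                    IsCycle E (a ∷ (x ∷ xs) ++ m ∷ reverse xs′)
  diverging-cycle {k} {a} {m} {x} {xs} {xs′} ra dv rm walk walk′ =
    three≤ , (a∉ ∷ unique-tail) , Linked-++⁻ˡ cycle (subst (Linked E) closes loop) ,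
    a , closing
    where
    p = x ∷ xs
    cycle = a ∷ p ++ m ∷ reverse xs′
    rp  = diverging-rankedˡ dv
    rp′ = diverging-rankedʳ dv
    three≤ : 3 ≤ length cycle
    three≤ rewrite length-++ xs {m ∷ reverse xs′} = s≤s (s≤s (≤-trans (s≤s z≤n) (m≤n+m _ (length xs))))
    above-a : ∀ {y} → y ∈ p ++ m ∷ reverse xs′ → suc k ≤ r y
    above-a y∈ with ∈-++⁻ p y∈
    ... | inj₁ y∈p            = ranked-≤ rp y∈p
    ... | inj₂ (here refl)    = subst (suc k ≤_) (sym rm) (m≤m+n (suc k) _)
    ... | inj₂ (there y∈rev)  = ranked-≤ rp′ (reverse⁻ y∈rev)
    a∉ : All.All (a ≢_) (p ++ m ∷ reverse xs′)
    a∉ = All.tabulate λ {y} y∈ a≡y → <-irrefl (cong r a≡y) (subst (_≤ r y) (cong suc (sym ra)) (above-a y∈))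
    m∉rev : All.All (m ≢_) (reverse xs′)
    m∉rev = All.tabulate λ y∈ m≡y → <-irrefl (trans rm (cong (suc k +_) (diverging-length dv)))
                                              (subst (λ y → r y < _) (sym m≡y) (ranked-< rp′ (reverse⁻ y∈)))
    unique-tail : Unique (p ++ m ∷ reverse xs′)
    unique-tail = Unique.++⁺ (ranked⇒unique rp) (m∉rev ∷ Unique-reverse (ranked⇒unique rp′))
      λ { (y∈p , here refl)     → <-irrefl rm (ranked-< rp y∈p)
        ; (y∈p , there y∈rev)   → diverging-disjoint dv y∈p (reverse⁻ y∈rev) }
    back : Linked E (m ∷ reverse xs′ ++ [ a ])
    back = subst (Linked E) reversed (Linked-reverse E-sym walk′)
      where
      reversed : reverse (a ∷ xs′ ++ [ m ]) ≡ m ∷ reverse xs′ ++ [ a ]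
      reversed = trans (unfold-reverse a (xs′ ++ [ m ])) (cong (_++ [ a ]) (reverse-++-∷ xs′ m []))
    loop : Linked E ((a ∷ p) ++ m ∷ reverse xs′ ++ [ a ])
    loop = Linked-glue (a ∷ p) m _ walk back
    closes : (a ∷ p) ++ m ∷ reverse xs′ ++ [ a ] ≡ cycle ++ [ a ]
    closes = cong (a ∷_) (sym (++-assoc p (m ∷ reverse xs′) [ a ]))
    closing : ∃[ y ] (head cycle ≡ just a × last cycle ≡ just y × E y a)
    closing with y , last≡ , e ← Linked-∷ʳ-last a (p ++ m ∷ reverse xs′) a (subst (Linked E) closes loop) =
      y , refl , last≡ , e

  diverged-walks-cannot-rejoin :
    ∀ {k a x xs xs′} (ys ys′ : List (V {n})) y → r a ≡ k → Diverging (suc k) (x ∷ xs) xs′ →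
    Ranked (suc k + length (x ∷ xs)) (ys ++ [ y ]) → Ranked (suc k + length (x ∷ xs)) (ys′ ++ [ y ]) →
    Linked E (a ∷ (x ∷ xs) ++ ys ++ [ y ]) → Linked E (a ∷ xs′ ++ ys′ ++ [ y ]) → ⊥
  diverged-walks-cannot-rejoin [] [] y ra dv (ry ∷ []) _ walk walk′ =
    acyclic _ (diverging-cycle ra dv ry walk walk′)
  diverged-walks-cannot-rejoin [] (z′ ∷ ys′) y ra dv (ry ∷ []) (_ ∷ rys′) _ _ =
    <-irrefl (sym ry) (ranked-≤ rys′ (∈-++⁺ʳ ys′ (here refl)))
  diverged-walks-cannot-rejoin (z ∷ ys) [] y ra dv (_ ∷ rys) (ry ∷ []) _ _ =
    <-irrefl (sym ry) (ranked-≤ rys (∈-++⁺ʳ ys (here refl)))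
  diverged-walks-cannot-rejoin {k} {a} {x} {xs} {xs′} (z ∷ ys) (z′ ∷ ys′) y ra dv (rz ∷ rys) (rz′ ∷ rys′) walk walk′
    with z Fin.≟ z′
  ... | yes refl = acyclic _ (diverging-cycle ra dv rz (Linked-++-∷⁻ˡ (a ∷ x ∷ xs) z walk) (Linked-++-∷⁻ˡ (a ∷ xs′) z walk′))
  ... | no z≢z′  = diverged-walks-cannot-rejoin ys ys′ y ra (diverging-∷ʳ dv rz rz′ z≢z′)
                     (subst (λ j → Ranked j (ys ++ [ y ])) grown rys)
                     (subst (λ j → Ranked j (ys′ ++ [ y ])) grown rys′)
                     (subst (λ l → Linked E (a ∷ l)) (sym (++-assoc (x ∷ xs) [ z ] (ys ++ [ y ]))) walk)
                     (subst (λ l → Linked E (a ∷ l)) (sym (++-assoc xs′ [ z′ ] (ys′ ++ [ y ]))) walk′)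
    where
    grown : suc (suc k + length (x ∷ xs)) ≡ suc k + length ((x ∷ xs) ++ [ z ])
    grown = begin
      suc (suc k + length (x ∷ xs))       ≡⟨ +-suc (suc k) (length (x ∷ xs)) ⟨
      suc k + suc (length (x ∷ xs))       ≡⟨ cong (suc k +_) (+-comm 1 (length (x ∷ xs))) ⟩
      suc k + (length (x ∷ xs) + 1)       ≡⟨ cong (suc k +_) (length-++ (x ∷ xs)) ⟨
      suc k + length ((x ∷ xs) ++ [ z ])  ∎
      where open ≡-Reasoning

  ranked-walks-unique : ∀ {k a} (xs xs′ : List (V {n})) y →
    Ranked k (a ∷ xs ++ [ y ]) → Ranked k (a ∷ xs′ ++ [ y ]) →
    Linked E (a ∷ xs ++ [ y ]) → Linked E (a ∷ xs′ ++ [ y ]) → xs ≡ xs′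
  ranked-walks-unique [] [] y _ _ _ _ = refl
  ranked-walks-unique [] (z′ ∷ xs′) y (_ ∷ ry ∷ []) (_ ∷ _ ∷ rxs′) _ _ =
    ⊥-elim (<-irrefl (sym ry) (ranked-≤ rxs′ (∈-++⁺ʳ xs′ (here refl))))
  ranked-walks-unique (z ∷ xs) [] y (_ ∷ _ ∷ rxs) (_ ∷ ry ∷ []) _ _ =
    ⊥-elim (<-irrefl (sym ry) (ranked-≤ rxs (∈-++⁺ʳ xs (here refl))))
  ranked-walks-unique {k} (z ∷ xs) (z′ ∷ xs′) y (ra ∷ rz ∷ rxs) (_ ∷ rz′ ∷ rxs′) walk walk′ with z Fin.≟ z′
  ... | yes refl = cong (z ∷_) (ranked-walks-unique xs xs′ y (rz ∷ rxs) (rz′ ∷ rxs′) (Linked.tail walk) (Linked.tail walk′))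
  ... | no z≢z′  = ⊥-elim (diverged-walks-cannot-rejoin xs xs′ y ra (step rz rz′ z≢z′ [])
                     (subst (λ j → Ranked j (xs ++ [ y ])) (+-comm 1 (suc k)) rxs)
                     (subst (λ j → Ranked j (xs′ ++ [ y ])) (+-comm 1 (suc k)) rxs′) walk walk′)

+-≤-tight : ∀ {a b A B} → a ≤ A → b ≤ B → A + B ≤ a + b → a ≡ A × b ≡ B
+-≤-tight {a} {b} {A} {B} a≤A b≤B A+B≤ =
  ≤-antisym a≤A (+-cancelʳ-≤ B A a (≤-trans A+B≤ (+-monoʳ-≤ a b≤B))) ,
  ≤-antisym b≤B (+-cancelˡ-≤ A B b (≤-trans A+B≤ (+-monoˡ-≤ b a≤A)))

≤-complement : ∀ {a b c e} → a + b ≡ c + e → a ≤ c → e ≤ b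
≤-complement {a} {b} {c} {e} eq a≤c = +-cancelˡ-≤ c e b (≤-trans (≤-reflexive (sym eq)) (+-monoˡ-≤ b a≤c))

nine-twelfths : ∀ q → 4 * (9 * q) ≡ 3 * (12 * q)
nine-twelfths = solve-∀

eight-plus-one : ∀ q → 8 * q + q ≡ 9 * q
eight-plus-one = solve-∀

pivot-split : ∀ q f → (4 * q + f) + 8 * q ≡ 12 * q + f
pivot-split = solve-∀

heavy-light-span : ∀ q f → (3 * q + f) + q + 8 * q ≡ 12 * q + f
heavy-light-span = solve-∀

heavy-light-top : ∀ q f → (3 * q + f) + q ≡ 4 * q + f
heavy-light-top = solve-∀

light-light-span : ∀ q f → (4 * q + f) + q + 7 * q ≡ 12 * q + f
light-light-span = solve-∀

excess≤ : ∀ q f → 4 * (12 * q + f) ≤ 5 * (12 * q) → f ≤ 3 * q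
excess≤ q f bound =
  *-cancelˡ-≤ 4 (+-cancelˡ-≤ (48 * q) (4 * f) (4 * (3 * q)) (subst₂ _≤_ (expand-lhs q f) (expand-rhs q) bound))
  where
  expand-lhs : ∀ a b → 4 * (12 * a + b) ≡ 48 * a + 4 * b
  expand-lhs = solve-∀
  expand-rhs : ∀ a → 5 * (12 * a) ≡ 48 * a + 4 * (3 * a)
  expand-rhs = solve-∀

module ShortestPaths {n : ℕ} (Adj : V {n} → V {n} → Set) (d : V {n} → V {n} → ℕ)
                     (P : V {n} → V {n} → List (V {n}))
                     (dist : IsDistance Adj d) (paths : IsPathSystem Adj d P) where
  open IsWalk
  open Ranking

  walk-split : ∀ {u v} as x bs → IsWalk Adj u v (as ++ x ∷ bs) →
               IsWalk Adj u x (as ++ [ x ]) × IsWalk Adj x v (x ∷ bs)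
  walk-split as x bs w =
    record { starts = trans (sym (head-++-∷ as x bs)) (starts w)
           ; ends   = last-++-[] as x
           ; linked = Linked-++-∷⁻ˡ as x (linked w) } ,
    record { starts = refl
           ; ends   = trans (sym (last-++-∷ as x bs)) (ends w)
           ; linked = Linked-++⁻ʳ as (linked w) }

  walk-++ : ∀ {u x v p q} → IsWalk Adj u x p → IsWalk Adj x v q →
            ∃[ c ] (IsWalk Adj u v c × suc (length c) ≡ length p + length q)
  walk-++ {u} {x} {v} {p} {q} wp wq
    with as , refl ← last≡just⇒∷ʳ p (ends wp) | bs , refl ← head≡just⇒∷ q (starts wq) =
    as ++ x ∷ bs ,
    record { starts = trans (head-++-∷ as x bs) (starts wp)
           ; ends   = trans (last-++-∷ as x bs) (ends wq)
           ; linked = Linked-glue as x bs (linked wp) (linked wq) } ,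
    (begin
      suc (length (as ++ x ∷ bs))            ≡⟨ cong suc (length-++ as) ⟩
      suc (length as + suc (length bs))      ≡⟨ cong (_+ suc (length bs)) (+-comm 1 (length as)) ⟩
      (length as + 1) + suc (length bs)      ≡⟨ cong (_+ suc (length bs)) (length-++ as) ⟨
      length (as ++ [ x ]) + length (x ∷ bs) ∎)
    where open ≡-Reasoning

  d-shortest : ∀ {u v p} → IsWalk Adj u v p → suc (d u v) ≤ length p
  d-shortest {u} {v} = proj₂ (dist u v) _

  d-triangle : ∀ a b c → d a c ≤ d a b + d b c
  d-triangle a b c
    with p , wp , lp ← proj₁ (dist a b) | q , wq , lq ← proj₁ (dist b c)
    with r , wr , lr ← walk-++ wp wq = s≤s⁻¹ (begin
      suc (d a c)                ≤⟨ d-shortest wr ⟩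
      length r                   ≡⟨ suc-injective (trans lr (cong₂ _+_ lp lq)) ⟩
      d a b + suc (d b c)        ≡⟨ +-suc (d a b) (d b c) ⟩
      suc (d a b + d b c)        ∎)
    where open ≤-Reasoning

  P-walk : ∀ u v → IsWalk Adj u v (P u v)
  P-walk u v = proj₁ (proj₁ paths u v)

  P-length : ∀ u v → length (P u v) ≡ suc (d u v)
  P-length u v = proj₂ (proj₁ paths u v)

  P-reverse : ∀ u v → P v u ≡ reverse (P u v)
  P-reverse = proj₁ (proj₂ paths)

  P-split-length : ∀ {u v} as x bs → P u v ≡ as ++ x ∷ bs → length as + length bs ≡ d u v
  P-split-length {u} {v} as x bs P≡ = suc-injective (begin
    suc (length as + length bs)  ≡⟨ +-suc (length as) (length bs) ⟨
    length as + length (x ∷ bs)  ≡⟨ length-++ as ⟨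
    length (as ++ x ∷ bs)        ≡⟨ cong length P≡ ⟨
    length (P u v)               ≡⟨ P-length u v ⟩
    suc (d u v)                  ∎)
    where open ≡-Reasoning

  -- The two halves of P(u,v) at x have lengths summing to d(u,v), so by the triangle inequality both are shortest.
  d-along-P : ∀ {u v} as x bs → P u v ≡ as ++ x ∷ bs → d u x ≡ length as × d x v ≡ length bs
  d-along-P {u} {v} as x bs P≡ with wux , wxv ← walk-split as x bs (subst (IsWalk Adj u v) P≡ (P-walk u v)) =
    +-≤-tight (s≤s⁻¹ (≤-trans (d-shortest wux) (≤-reflexive (trans (length-++ as) (+-comm (length as) 1)))))
              (s≤s⁻¹ (d-shortest wxv))
              (≤-trans (≤-reflexive (P-split-length as x bs P≡)) (d-triangle u x v))

  P-ranked : ∀ u v → Ranked (d u) 0 (P u v)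
  P-ranked u v = ranked⁺ (d u) 0 (P u v) λ as x bs P≡ → proj₁ (d-along-P as x bs P≡)

  P-head : ∀ {u v a l} → P u v ≡ a ∷ l → a ≡ u
  P-head {u} {v} P≡ = just-injective (trans (cong head (sym P≡)) (starts (P-walk u v)))

  UnionEdge-sym : ∀ {u x y} → UnionEdge P u x y → UnionEdge P u y x
  UnionEdge-sym (v , inj₁ c) = v , inj₂ c
  UnionEdge-sym (v , inj₂ c) = v , inj₁ c

  Consecutive-linked : ∀ (as xs : List (V {n})) → Linked (Consecutive (as ++ xs)) xs
  Consecutive-linked as []           = []
  Consecutive-linked as (x ∷ [])     = [-]
  Consecutive-linked as (x ∷ y ∷ xs) = (as , xs , refl) ∷
    subst (λ l → Linked (Consecutive l) (y ∷ xs)) (++-assoc as [ x ] (y ∷ xs)) (Consecutive-linked (as ++ [ x ]) (y ∷ xs))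

  P-linked : ∀ u v → Linked (UnionEdge P u) (P u v)
  P-linked u v = Linked.map (λ c → v , inj₁ c) (Consecutive-linked [] (P u v))

  -- Both prefixes are u–y walks in the acyclic union tree, ranked by the distance from u, hence equal.
  P-prefix-unique : ∀ {u v v′ y} as bs cs es → P u v ≡ as ++ y ∷ bs → P u v′ ≡ cs ++ y ∷ es → as ≡ cs
  P-prefix-unique []       bs []       es _   _    = refl
  P-prefix-unique []       bs (c ∷ cs) es P≡  P′≡
    with () ← trans (sym (proj₁ (d-along-P [] _ bs P≡))) (proj₁ (d-along-P (c ∷ cs) _ es P′≡))
  P-prefix-unique (a ∷ as) bs []       es P≡  P′≡
    with () ← trans (sym (proj₁ (d-along-P (a ∷ as) _ bs P≡))) (proj₁ (d-along-P [] _ es P′≡))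
  P-prefix-unique {u} {v} {v′} {y} (a ∷ as) bs (c ∷ cs) es P≡ P′≡ with refl ← P-head P≡ | refl ← P-head P′≡ =
    cong (u ∷_) (RankedWalks.ranked-walks-unique (d u) (UnionEdge P u) UnionEdge-sym union-acyclic
                   as cs y (prefix-ranked P≡) (prefix-ranked P′≡) (prefix-linked P≡) (prefix-linked P′≡))
    where
    union-acyclic : Acyclic (UnionEdge P u)
    union-acyclic = proj₂ (proj₂ (proj₂ paths) u)
    prefix-ranked : ∀ {w xs zs} → P u w ≡ (u ∷ xs) ++ y ∷ zs → Ranked (d u) 0 (u ∷ xs ++ [ y ])
    prefix-ranked {w} {xs} {zs} P≡ = ranked-++⁻ˡ (d u) (u ∷ xs ++ [ y ])
      (subst (Ranked (d u) 0) (trans P≡ (cong (u ∷_) (sym (++-assoc xs [ y ] zs)))) (P-ranked u w))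
    prefix-linked : ∀ {w xs zs} → P u w ≡ (u ∷ xs) ++ y ∷ zs → Linked (UnionEdge P u) (u ∷ xs ++ [ y ])
    prefix-linked {w} {xs} P≡ = Linked-++-∷⁻ˡ (u ∷ xs) y (subst (Linked (UnionEdge P u)) P≡ (P-linked u w))

  P-prefix-closed : ∀ {u v v′ x y} → y ∈ P u v → y ∈ P u v′ → x ∈ P u v′ → d u x ≤ d u y → x ∈ P u v
  P-prefix-closed {u} {v} {v′} {x} {y} y∈ y∈′ x∈′ x≤y
    with as , bs , P≡ ← ∈-∃++ y∈ | cs , es , P′≡ ← ∈-∃++ y∈′
    with refl ← P-prefix-unique as bs cs es P≡ P′≡
    with ∈-++⁻ as (subst (x ∈_) P′≡ x∈′)
  ... | inj₁ x∈as        = subst (x ∈_) (sym P≡) (∈-++⁺ˡ x∈as)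
  ... | inj₂ (here refl) = y∈
  ... | inj₂ (there x∈es) = ⊥-elim (<⇒≱ y<x x≤y)
    where
    y<x : d u y < d u x
    y<x with _ ∷ res ← ranked-++⁻ʳ (d u) as (subst (Ranked (d u) 0) P′≡ (P-ranked u v′)) =
      subst (_< d u x) (sym (proj₁ (d-along-P as y es P′≡))) (ranked-≤ (d u) res x∈es)

  ∈-P-sym : ∀ {u v x} → x ∈ P u v → x ∈ P v u
  ∈-P-sym {u} {v} x∈ = subst (_ ∈_) (sym (P-reverse u v)) (reverse⁺ x∈)

  d-sym : ∀ u v → d v u ≡ d u v
  d-sym u v = suc-injective (begin
    suc (d v u)            ≡⟨ P-length v u ⟨
    length (P v u)         ≡⟨ cong length (P-reverse u v) ⟩
    length (reverse (P u v)) ≡⟨ length-reverse (P u v) ⟩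
    length (P u v)         ≡⟨ P-length u v ⟩
    suc (d u v)            ∎)
    where open ≡-Reasoning

  d-on-P : ∀ {u v x} → x ∈ P u v → d u x + d x v ≡ d u v
  d-on-P {u} {v} {x} x∈ with as , bs , P≡ ← ∈-∃++ x∈ with ux≡ , xv≡ ← d-along-P as x bs P≡ =
    trans (cong₂ _+_ ux≡ xv≡) (P-split-length as x bs P≡)

  P-at-depth : ∀ {u v} i → i ≤ d u v → ∃[ x ] (x ∈ P u v × d u x ≡ i)
  P-at-depth {u} {v} i i≤ = ranked-at (d u) i (P-ranked u v) (subst (i <_) (sym (P-length u v)) (s≤s i≤))

-- An injection Fin m → Q exists iff Q has at least m elements, which is decidable by counting.
∃-injection? : ∀ {n} {Q : Fin n → Set} → (∀ z → Dec (Q z)) → ∀ m →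
               Dec (∃[ f ] (Injective _≡_ _≡_ f × ∀ (i : Fin m) → Q (f i)))
∃-injection? {n} {Q} Q? m with m ≤? length (filter Q? (allFin n))
... | yes m≤ = yes (f , f-injective , λ i → proj₂ (∈-filter⁻ Q? {xs = allFin n} (∈-lookup (inject≤ i m≤))))
  where
  f : Fin m → Fin n
  f i = lookup (filter Q? (allFin n)) (inject≤ i m≤)
  f-injective : Injective _≡_ _≡_ f
  f-injective {i} {j} eq =
    Fin.inject≤-injective m≤ m≤ i j (lookup-injective (Unique.filter⁺ Q? (Unique.allFin⁺ n)) _ _ eq)
... | no m≰ = no λ (f , f-injective , Qf) →
  let f∈ : ∀ i → f i ∈ filter Q? (allFin n)
      f∈ i = ∈-filter⁺ Q? (∈-allFin (f i)) (Qf i)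
  in m≰ (Fin.injective⇒≤ {f = λ i → index (f∈ i)} λ {i} {j} eq →
           f-injective (trans (lookup-index (f∈ i)) (trans (cong (lookup (filter Q? (allFin n))) eq) (sym (lookup-index (f∈ j))))))

module HubSets {n : ℕ} (Adj : V {n} → V {n} → Set) (d : V {n} → V {n} → ℕ) (P : V {n} → V {n} → List (V {n}))
               (dist : IsDistance Adj d) (paths : IsPathSystem Adj d P) (𝒟 : ℕ) (ρ : V {n} → ℚ) where
  open ShortestPaths Adj d P dist paths
  open Setting d P 𝒟 ρ
  open import Data.List.Membership.DecPropositional {A = Fin n} Fin._≟_ using (_∈?_)

  InRange? : ∀ k → Dec (InRange k)
  InRange? k = (𝒟 ≤? k) ×-dec (4 * k ≤? 5 * 𝒟)

  Anc? : ∀ u w x → Dec (Anc u w x)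
  Anc? u w x = Fin.any? λ v → InRange? (d u v) ×-dec (w ∈? P u v) ×-dec (x ∈? P u v) ×-dec (d u w ≤? d u x)

  InTs? : ∀ u x → Dec (InTs u x)
  InTs? u x = Fin.any? (λ v → InRange? (d u v) ×-dec (x ∈? P u v)) ×-dec (4 * d u x ≤? 3 * 𝒟)

  Leaf? : ∀ u x → Dec (Leaf u x)
  Leaf? u x = InTs? u x ×-dec Fin.all? λ y → ¬? (InTs? u y ×-dec Anc? u x y ×-dec (d u y ≟ suc (d u x)))

  ManyLeaves? : ∀ u w → Dec (ManyLeaves u w)
  ManyLeaves? u w = ∃-injection? (λ z → Leaf? u z ×-dec Anc? u w z) 𝒟

  InTs-on-P : ∀ {r o x} → InRange (d r o) → x ∈ P r o → 4 * d r x ≤ 3 * 𝒟 → InTs r x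
  InTs-on-P {o = o} inR x∈ shallow = (o , inR , x∈) , shallow

  Anc-on-P : ∀ {r o x b} → Anc r x b → b ∈ P r o → x ∈ P r o
  Anc-on-P (_ , _ , x∈′ , b∈′ , x≤b) b∈ = P-prefix-closed b∈ b∈′ x∈′ x≤b

  ManyLeaves-ancestor : ∀ {r o x y} → y ∈ P r o → x ∈ P r o → d r x ≤ d r y → ManyLeaves r y → ManyLeaves r x
  ManyLeaves-ancestor {r} {o} {x} {y} y∈ x∈ x≤y (f , f-injective , leaves) =
    f , f-injective , λ i → proj₁ (leaves i) , below-x (proj₂ (leaves i))
    where
    below-x : ∀ {z} → Anc r y z → Anc r x z
    below-x (o′ , inR , y∈′ , z∈′ , y≤z) = o′ , inR , P-prefix-closed y∈′ y∈ x∈ x≤y , z∈′ , ≤-trans x≤y y≤z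

  Window : V → ℕ → ℕ → V → Set
  Window r s t x = s ≤ d r x × d r x ≤ s + t

  Window? : ∀ r s t x → Dec (Window r s t x)
  Window? r s t x = (s ≤? d r x) ×-dec (d r x ≤? s + t)

  record WindowMin (r o : V) (s t : ℕ) (w : V) : Set where
    field
      on-path   : w ∈ P r o
      in-window : Window r s t w
      minimal   : ∀ x → x ∈ P r o → Window r s t x → ρ w ℚ.≤ ρ x

  windowMin-exists : ∀ r o s t → s + t ≤ d r o → ∃[ w ] WindowMin r o s t w
  windowMin-exists r o s t s+t≤ with x₀ , x₀∈ , x₀≡ ← P-at-depth s (≤-trans (m≤m+n s t) s+t≤) =
    argmin ρ x₀ candidates ,
    record { on-path   = proj₁ argmin-admissible
           ; in-window = proj₂ argmin-admissible
           ; minimal   = λ x x∈ window → All.lookup (f[argmin]≤f[xs] x₀ candidates) (∈-filter⁺ (Window? r s t) x∈ window) }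
    where
    candidates = filter (Window? r s t) (P r o)
    argmin-admissible : argmin ρ x₀ candidates ∈ P r o × Window r s t (argmin ρ x₀ candidates)
    argmin-admissible = argmin-all ρ (x₀∈ , ≤-reflexive (sym x₀≡) , ≤-trans (≤-reflexive x₀≡) (m≤m+n s t))
                          (All.tabulate (∈-filter⁻ (Window? r s t) {xs = P r o}))

  window-mirror : ∀ {u v s t s′ x} → s + t + s′ ≡ d u v → x ∈ P u v → Window u s t x → Window v s′ t x
  window-mirror {u} {v} {s} {t} {s′} {x} span x∈ (s≤ , ≤s+t) =
    ≤-complement (trans along (sym span)) ≤s+t ,
    ≤-complement (trans (trans shuffle span) (sym along)) s≤
    where
    along : d u x + d v x ≡ d u v
    along = trans (cong (d u x +_) (d-sym x v)) (d-on-P x∈)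
    shuffle : s + (s′ + t) ≡ s + t + s′
    shuffle = trans (cong (s +_) (+-comm s′ t)) (sym (+-assoc s t s′))

  WindowMin-mirror : ∀ {u v s t s′ w} → s + t + s′ ≡ d u v → WindowMin u v s t w → WindowMin v u s′ t w
  WindowMin-mirror {u} {v} {s} {t} {s′} span wm = record
    { on-path   = ∈-P-sym on-path
    ; in-window = window-mirror span on-path in-window
    ; minimal   = λ x x∈ window → minimal x (∈-P-sym x∈) (window-mirror span′ x∈ window)
    }
    where
    open WindowMin wm
    span′ : s′ + t + s ≡ d v u
    span′ = begin
      s′ + t + s   ≡⟨ +-comm (s′ + t) s ⟩
      s + (s′ + t) ≡⟨ cong (s +_) (+-comm s′ t) ⟩
      s + (t + s′) ≡⟨ +-assoc s t s′ ⟨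
      s + t + s′   ≡⟨ span ⟩
      d u v        ≡⟨ d-sym u v ⟨
      d v u        ∎
      where open ≡-Reasoning

  shallow⇒≤d : ∀ {r o X} → InRange (d r o) → 4 * X ≤ 3 * 𝒟 → X ≤ d r o
  shallow⇒≤d (𝒟≤ , _) shallow =
    ≤-trans (*-cancelˡ-≤ 4 (≤-trans shallow (*-monoˡ-≤ 𝒟 (m≤m+n 3 1)))) 𝒟≤

  module _ {r o : V} (inR : InRange (d r o)) {s t : ℕ} (t≡ : t ≡ 𝒟 / 12) (shallow : 4 * (s + t) ≤ 3 * 𝒟) where

    Window-InTs : ∀ {x} → x ∈ P r o → Window r s t x → InTs r x
    Window-InTs x∈ (_ , ≤s+t) = InTs-on-P inR x∈ (≤-trans (*-monoʳ-≤ 4 ≤s+t) shallow)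

    WindowMin-∈-H : ∀ {w y} → WindowMin r o s t w → y ∈ P r o → s + t ≤ d r y → ManyLeaves r y → H r w
    WindowMin-∈-H wm y∈ s+t≤ heavy =
      Window-InTs on-path in-window ,
      ManyLeaves-ancestor y∈ on-path (≤-trans (proj₂ in-window) s+t≤) heavy
      where open WindowMin wm

    -- The window itself is the descending subpath P_d of T_r^*[L_r] that witnesses w ∈ L_r′.
    WindowMin-∈-L′ : ∀ {w y} → WindowMin r o s t w → y ∈ P r o → d r y ≤ s → ¬ ManyLeaves r y → L′ r w
    WindowMin-∈-L′ {w} {y} wm y∈ y≤s light
      with a , a∈ , a≡ ← P-at-depth s (≤-trans (m≤m+n s t) (shallow⇒≤d inR shallow))
         | b , b∈ , b≡ ← P-at-depth (s + t) (shallow⇒≤d inR shallow) =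
      window-L on-path in-window , a , b ,
      (o , inR , a∈ , b∈ , subst₂ _≤_ (sym a≡) (sym b≡) (m≤m+n s t)) ,
      trans (cong₂ _+_ a≡ (sym t≡)) (sym b≡) ,
      (λ x seg → window-L (segment-on-P seg) (segment-window seg)) ,
      ((o , inR , a∈ , on-path , subst (_≤ d r w) (sym a≡) (proj₁ in-window)) ,
       (o , inR , on-path , b∈ , subst (d r w ≤_) (sym b≡) (proj₂ in-window))) ,
      (λ x seg → minimal x (segment-on-P seg) (segment-window seg))
      where
      open WindowMin wm
      window-L : ∀ {x} → x ∈ P r o → Window r s t x → L r x
      window-L x∈ window = Window-InTs x∈ window ,
        λ heavy → light (ManyLeaves-ancestor x∈ y∈ (≤-trans y≤s (proj₁ window)) heavy)
      segment-on-P : ∀ {x} → OnSeg r a b x → x ∈ P r o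
      segment-on-P (_ , x-above-b) = Anc-on-P x-above-b b∈
      segment-window : ∀ {x} → OnSeg r a b x → Window r s t x
      segment-window {x} ((_ , _ , _ , _ , a≤x) , (_ , _ , _ , _ , x≤b)) =
        subst (_≤ d r x) a≡ a≤x , subst (d r x ≤_) b≡ x≤b

  SMidpoint : V → V → Set
  SMidpoint u v = ∃[ w ] (S u w × S v w × d u w + d w v ≡ d u v)

  SMidpoint-sym : ∀ {u v} → SMidpoint v u → SMidpoint u v
  SMidpoint-sym {u} {v} (w , Sv , Su , vwu) = w , Su , Sv , (begin
    d u w + d w v ≡⟨ cong₂ _+_ (d-sym w u) (d-sym v w) ⟩
    d w u + d v w ≡⟨ +-comm (d w u) (d v w) ⟩
    d v w + d w u ≡⟨ vwu ⟩
    d v u         ≡⟨ d-sym u v ⟩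
    d u v         ∎)
    where open ≡-Reasoning

  module Construction (q f : ℕ) (𝒟≡ : 𝒟 ≡ 12 * q) (f≤ : f ≤ 3 * q) where

    q≡ : q ≡ 𝒟 / 12
    q≡ = sym (trans (cong (_/ 12) (trans 𝒟≡ (*-comm 12 q))) (m*n/n≡m q 12))

    scale : ∀ {a b} → a ≤ b → a * q ≤ b * q
    scale = *-monoˡ-≤ q

    +f≤ : ∀ a → a * q + f ≤ (a + 3) * q
    +f≤ a = ≤-trans (+-monoʳ-≤ (a * q) f≤) (≤-reflexive (sym (*-distribʳ-+ q a 3)))

    4q+f≤7q : 4 * q + f ≤ 7 * q
    4q+f≤7q = +f≤ 4

    4q+f≤8q : 4 * q + f ≤ 8 * q
    4q+f≤8q = ≤-trans 4q+f≤7q (scale (m≤m+n 7 1))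

    3q+f≤8q : 3 * q + f ≤ 8 * q
    3q+f≤8q = ≤-trans (+f≤ 3) (scale (m≤m+n 6 2))

    ≤9q-shallow : ∀ {X} → X ≤ 9 * q → 4 * X ≤ 3 * 𝒟
    ≤9q-shallow X≤ = ≤-trans (*-monoʳ-≤ 4 X≤) (≤-reflexive (trans (nine-twelfths q) (cong (3 *_) (sym 𝒟≡))))

    ≤8q-shallow : ∀ {X} → X ≤ 8 * q → 4 * X ≤ 3 * 𝒟
    ≤8q-shallow X≤ = ≤9q-shallow (≤-trans X≤ (scale (m≤m+n 8 1)))

    window-shallow : ∀ {s} → s ≤ 8 * q → 4 * (s + q) ≤ 3 * 𝒟
    window-shallow s≤ = ≤9q-shallow (≤-trans (+-monoˡ-≤ q s≤) (≤-reflexive (eight-plus-one q)))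

    module Pair {r o : V} (inR : InRange (d r o)) (dro : d r o ≡ 12 * q + f) where

      inR′ : InRange (d o r)
      inR′ = subst InRange (sym (d-sym r o)) inR

      pivot-far : ∀ {y} → y ∈ P r o → d r y ≡ 4 * q + f → d o y ≡ 8 * q
      pivot-far {y} y∈ ry = +-cancelˡ-≡ (4 * q + f) _ _ (begin
        4 * q + f + d o y  ≡⟨ cong₂ _+_ ry (d-sym o y) ⟨
        d r y + d y o      ≡⟨ d-on-P y∈ ⟩
        d r o              ≡⟨ dro ⟩
        12 * q + f         ≡⟨ pivot-split q f ⟨
        4 * q + f + 8 * q  ∎)
        where open ≡-Reasoning

      through-window : ∀ s s′ → s + q + s′ ≡ 12 * q + f → s ≤ 8 * q →
                       (∀ {w} → WindowMin r o s q w → S r w) → (∀ {w} → WindowMin o r s′ q w → S o w) →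
                       SMidpoint r o
      through-window s s′ span s≤ S-r S-o = midpoint (windowMin-exists r o s q fits)
        where
        fits : s + q ≤ d r o
        fits = shallow⇒≤d {r} {o} {s + q} inR (window-shallow s≤)
        midpoint : ∃[ w ] WindowMin r o s q w → SMidpoint r o
        midpoint (w , wm) =
          w , S-r wm , S-o (WindowMin-mirror {r} {o} {s} {q} {s′} (trans span (sym dro)) wm) ,
          d-on-P (WindowMin.on-path wm)

      both-heavy : ∀ {y} → y ∈ P r o → d r y ≡ 4 * q + f → ManyLeaves r y → ManyLeaves o y → SMidpoint r o
      both-heavy {y} y∈ ry heavy heavy′ =
        y , inj₁ (InTs-on-P inR y∈ (≤8q-shallow (≤-trans (≤-reflexive ry) 4q+f≤8q)) , heavy) ,
            inj₁ (InTs-on-P inR′ (∈-P-sym y∈) (≤8q-shallow (≤-reflexive (pivot-far y∈ ry))) , heavy′) ,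
            d-on-P y∈

      heavy-light : ∀ {y} → y ∈ P r o → d r y ≡ 4 * q + f → ManyLeaves r y → ¬ ManyLeaves o y → SMidpoint r o
      heavy-light {y} y∈ ry heavy light =
        through-window (3 * q + f) (8 * q) (heavy-light-span q f) 3q+f≤8q
          (λ wm → inj₁ (WindowMin-∈-H inR q≡ (window-shallow 3q+f≤8q) wm y∈
                          (≤-reflexive (trans (heavy-light-top q f) (sym ry))) heavy))
          (λ wm → inj₂ (WindowMin-∈-L′ inR′ q≡ (window-shallow ≤-refl) wm (∈-P-sym y∈)
                          (≤-reflexive (pivot-far y∈ ry)) light))

      light-light : ∀ {y y′} → y ∈ P r o → d r y ≡ 4 * q + f → y′ ∈ P o r → d o y′ ≡ 4 * q + f →
                    ¬ ManyLeaves r y → ¬ ManyLeaves o y′ → SMidpoint r o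
      light-light y∈ ry y′∈ oy′ light light′ =
        through-window (4 * q + f) (7 * q) (light-light-span q f) 4q+f≤8q
          (λ wm → inj₂ (WindowMin-∈-L′ inR q≡ (window-shallow 4q+f≤8q) wm y∈ (≤-reflexive ry) light))
          (λ wm → inj₂ (WindowMin-∈-L′ inR′ q≡ (window-shallow (scale (m≤m+n 7 1))) wm y′∈
                          (≤-trans (≤-reflexive oy′) 4q+f≤7q) light′))

    light-heavy : ∀ {r o y y′} → InRange (d r o) → d r o ≡ 12 * q + f →
                  y ∈ P r o → d r y ≡ 4 * q + f → y′ ∈ P o r → d o y′ ≡ 4 * q + f →
                  ¬ ManyLeaves r y → ManyLeaves o y′ → SMidpoint r o
    light-heavy {r} {o} {y} {y′} inR dro y∈ ry y′∈ oy′ light heavy′ =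
      SMidpoint-sym (Pair.heavy-light (Pair.inR′ inR dro) (trans (d-sym r o) dro) y′∈ oy′ heavy′ λ heavy → light
        (ManyLeaves-ancestor (∈-P-sym y′∈) y∈ (subst₂ _≤_ (sym ry) (sym y′-far) 4q+f≤8q) heavy))
      where
      y′-far : d r y′ ≡ 8 * q
      y′-far = Pair.pivot-far (Pair.inR′ inR dro) (trans (d-sym r o) dro) y′∈ oy′

    pivot≤ : ∀ {r o} → d r o ≡ 12 * q + f → 4 * q + f ≤ d r o
    pivot≤ {r} {o} dro = subst (4 * q + f ≤_) (sym dro) (+-monoˡ-≤ f (scale (m≤m+n 4 8)))

    S-midpoint : ∀ {u v} → InRange (d u v) → d u v ≡ 12 * q + f → SMidpoint u v
    S-midpoint {u} {v} inR duv
      with x , x∈ , ux ← P-at-depth (4 * q + f) (pivot≤ duv)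
         | x′ , x′∈ , vx′ ← P-at-depth (4 * q + f) (pivot≤ (trans (d-sym u v) duv))
      with ManyLeaves? u x | ManyLeaves? v x | ManyLeaves? v x′
    ... | yes heavy | yes heavy′ | _          = Pair.both-heavy  inR duv x∈ ux heavy heavy′
    ... | yes heavy | no light′  | _          = Pair.heavy-light inR duv x∈ ux heavy light′
    ... | no light  | _          | yes heavy′ = light-heavy      inR duv x∈ ux x′∈ vx′ light heavy′
    ... | no light  | _          | no light′  = Pair.light-light inR duv x∈ ux x′∈ vx′ light light′

mainTheorem15 : ∀ {n : ℕ} (Adj : V {n} → V {n} → Set) (d : V {n} → V {n} → ℕ)
    (P : V {n} → V {n} → List (V {n})) (𝒟 : ℕ) →
    SimpleGraph Adj → Connected Adj → IsDistance Adj d → IsPathSystem Adj d P →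
    0 < 𝒟 → 12 ∣ 𝒟 →
    (ρ : V {n} → ℚ) → (∀ v → 0ℚ ℚ.≤ ρ v × ρ v ℚ.≤ 1ℚ) → Injective _≡_ _≡_ ρ →
    ∀ u v → 𝒟 ≤ d u v → 4 * d u v ≤ 5 * 𝒟 →
    (∃[ w ] (Setting.S d P 𝒟 ρ u w × Setting.S d P 𝒟 ρ v w × d u w + d w v ≡ d u v))
    × (∀ w → Setting.S d P 𝒟 ρ u w → Setting.S d P 𝒟 ρ v w → d u v ≤ d u w + d w v)
mainTheorem15 Adj d P 𝒟 _ _ dist paths _ (divides q 𝒟≡) ρ _ _ u v 𝒟≤ 4d≤
  with f , 𝒟+f≡ ← m≤n⇒∃[o]m+o≡n 𝒟≤ =
  Construction.S-midpoint q f 𝒟≡12q (excess≤ q f (subst₂ (λ a b → 4 * a ≤ 5 * b) duv 𝒟≡12q 4d≤)) (𝒟≤ , 4d≤) duv ,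
  λ w _ _ → d-triangle u w v
  where
  open HubSets Adj d P dist paths 𝒟 ρ
  open ShortestPaths Adj d P dist paths using (d-triangle)
  𝒟≡12q : 𝒟 ≡ 12 * q
  𝒟≡12q = trans 𝒟≡ (*-comm q 12)
  duv : d u v ≡ 12 * q + f
  duv = trans (sym 𝒟+f≡) (cong (_+ f) 𝒟≡12q)
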